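{- Let $G$ be a finite simple connected graph with maximum degree $2$. If $G$ is not isomorphic to $C_4$ or $C_7$, then $\chi'_{ss}(G)\le 3$ and $\chi'_{(0,1)}(G)\le 3$.
   Context: For $M\subseteq E(G)$, $G[V(M)]$ is the subgraph induced by the endvertices of edges of $M$; $M$ is a semistrong matching if every edge of $M$ has an endvertex of degree $1$ in $G[V(M)]$. $\chi'_{ss}(G)$ is the minimum $k$ such that the edges of $G$ can be colored with at most $k$ colors so that each color class is a semistrong matching. Two distinct edges are at distance $1$ if they share an endvertex, and at distance $2$ if they do not but some edge shares an endvertex with each of them. $\chi'_{(0,1)}(G)$ is the minimum $k$ such that the edges of $G$ can be colored with at most $k$ colors so that no two edges at distance $1$ receive the same color and every edge has at most one edge at distance $2$ with the same color as itself. $C_n$ is the cycle on $n$ vertices. -}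

module Defs where

open import Data.Nat using (ℕ; NonZero; _+_; _≤_; _<_; _%_; _≡ᵇ_)
open import Data.Bool using (Bool; true; false; if_then_else_; _∨_; T)
open import Data.Fin using (Fin; toℕ)
open import Data.List using (List; map; allFin)
open import Data.Nat.ListAction using (sum)
open import Data.Product using (Σ; ∃; _×_; _,_)
open import Data.Sum using (_⊎_)
open import Relation.Nullary using (¬_)
open import Relation.Binary.PropositionalEquality using (_≡_)
open import Function.Bundles using (_↔_; Inverse)

record Graph (n : ℕ) : Set where
  field
    Adj : Fin n → Fin n → Bool

open Graph public

_~[_]_ : {n : ℕ} → Fin n → Graph n → Fin n → Set
u ~[ G ] v = T (Adj G u v)

Simple : {n : ℕ} → Graph n → Set
Simple G = (∀ u v → Adj G u v ≡ Adj G v u) × (∀ u → Adj G u u ≡ false)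

deg : {n : ℕ} → Graph n → Fin n → ℕ
deg {n} G v = sum (map (λ w → if Adj G v w then 1 else 0) (allFin n))

MaxDegree : {n : ℕ} → Graph n → ℕ → Set
MaxDegree G d = (∀ v → deg G v ≤ d) × (∃ λ v → deg G v ≡ d)

data Walk {n : ℕ} (G : Graph n) : Fin n → Fin n → Set where
  here : ∀ {u} → Walk G u u
  step : ∀ {u v w} → u ~[ G ] v → Walk G v w → Walk G u w

Connected : {n : ℕ} → Graph n → Set
Connected G = ∀ u v → Walk G u v

cycle : (m : ℕ) → .{{_ : NonZero m}} → Graph m
cycle m = record { Adj = λ i j → (toℕ j ≡ᵇ ((toℕ i + 1) % m)) ∨ (toℕ i ≡ᵇ ((toℕ j + 1) % m)) }

Iso : {n m : ℕ} → Graph n → Graph m → Set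
Iso {n} {m} G H = Σ (Fin n ↔ Fin m) λ f →
  ∀ u v → Adj G u v ≡ Adj H (Inverse.to f u) (Inverse.to f v)

-- edges, each represented once with endpoints u < v
record Edge {n : ℕ} (G : Graph n) : Set where
  constructor edge
  field
    u v : Fin n
    u<v : toℕ u < toℕ v
    adj : u ~[ G ] v

open Edge public

_∈ₑ_ : {n : ℕ} {G : Graph n} → Fin n → Edge G → Set
x ∈ₑ e = x ≡ u e ⊎ x ≡ v e

Share : {n : ℕ} {G : Graph n} → Edge G → Edge G → Set
Share e f = ∃ λ x → x ∈ₑ e × x ∈ₑ f

Dist1 : {n : ℕ} {G : Graph n} → Edge G → Edge G → Set
Dist1 e f = ¬ (e ≡ f) × Share e f

Dist2 : {n : ℕ} {G : Graph n} → Edge G → Edge G → Set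
Dist2 {G = G} e f = ¬ (e ≡ f) × ¬ Share e f × (∃ λ (g : Edge G) → Share e g × Share g f)

EdgeColoring : {n : ℕ} → Graph n → ℕ → Set
EdgeColoring G k = Edge G → Fin k

InVM : {n k : ℕ} {G : Graph n} → EdgeColoring G k → Fin k → Fin n → Set
InVM {G = G} c α x = ∃ λ (e : Edge G) → c e ≡ α × x ∈ₑ e

-- x has degree exactly 1 in G[V(M_α)]: exactly one neighbour of x lies in V(M_α)
DegOneInVM : {n k : ℕ} {G : Graph n} → EdgeColoring G k → Fin k → Fin n → Set
DegOneInVM {G = G} c α x =
  ∃ λ w → (x ~[ G ] w × InVM c α w) × (∀ w' → x ~[ G ] w' → InVM c α w' → w' ≡ w)

Semistrong : {n k : ℕ} {G : Graph n} → EdgeColoring G k → Set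
Semistrong {G = G} c = ∀ (e : Edge G) → DegOneInVM c (c e) (u e) ⊎ DegOneInVM c (c e) (v e)

SSColorable : {n : ℕ} → Graph n → ℕ → Set
SSColorable G k = Σ (EdgeColoring G k) Semistrong

ZeroOne : {n k : ℕ} {G : Graph n} → EdgeColoring G k → Set
ZeroOne {G = G} c =
  (∀ (e f : Edge G) → Dist1 e f → ¬ (c e ≡ c f)) ×
  (∀ (e f g : Edge G) → Dist2 e f → c f ≡ c e → Dist2 e g → c g ≡ c e → f ≡ g)

ZeroOneColorable : {n : ℕ} → Graph n → ℕ → Set
ZeroOneColorable G k = Σ (EdgeColoring G k) ZeroOne

{-# OPTIONS --safe #-}

-- A connected graph of maximum degree 2 is a path or a cycle C_k. Number its edges along it and
-- give edge i the colour σ i, where σ : ℕ → Fin 3 satisfies σ i ≢ σ (1 + i) and never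
-- σ i ≡ σ (2 + i) ≡ σ (4 + i). Both properties follow: the edges at distance 2 from edge i are
-- edges i ± 2, and an endpoint of edge i has a second neighbour in its colour class only if edge
-- i - 2, resp. i + 2, has the same colour, which cannot happen at both ends at once.
-- On a path, σ i = i mod 3 works. On C_k, σ must moreover be k-periodic. σ i = ⌊(k + b) i / k⌋ mod 3
-- is, when 3 ∣ k + b; when also 4 b < k, the values of ⌊(k + b) i / k⌋ one, two and four steps apart
-- differ by 1 or 2, 2 or 3, and 4 or 5, which gives both conditions. Such a b exists for every k ≥ 3
-- except 4 and 7.

module Submission where

open import Defs
open import Data.Nat
  using (ℕ; zero; suc; pred; _+_; _*_; _/_; _%_; _≡ᵇ_; _≤_; _<_; z≤n; s≤s; s≤s⁻¹; NonZero; >-nonZero)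
open import Data.Nat.Properties
  using ( _≟_; _≤?_; _<?_; ≡ᵇ⇒≡; ≡⇒≡ᵇ; suc-injective; +-suc; +-comm; +-assoc; +-identityʳ; *-distribˡ-+
        ; ≤-refl; ≤-reflexive; ≤-trans; ≤-antisym; ≤-<-trans; <-≤-trans; <-trans; <⇒≤; <-irrefl; <-asym
        ; <-irrelevant; ≰⇒>; ≮⇒≥; m≤n⇒m<n∨m≡n; m≤m+n; m≤n+m; m+n≤o⇒n≤o; m≢1+n+m; n≢0⇒n>0
        ; suc-pred; pred[n]≤n; pred-mono-≤; +-mono-≤; +-monoˡ-≤; *-monoʳ-≤; anyUpTo?
        ; +-0-commutativeMonoid; module ≤-Reasoning )
open import Data.Nat.DivMod
  using (m%n<n; m<n⇒m%n≡m; n%n≡0; m≡m%n+[m/n]*n; /-monoˡ-≤; +-distrib-/-∣ˡ; +-distrib-/-∣ʳ; n/n≡1; m*n/n≡m)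
open import Data.Nat.Divisibility using (∣-refl; n∣m*n)
open import Data.Nat.ListAction using () renaming (sum to listSum)
open import Data.Nat.Tactic.RingSolver using (solve-∀)
open import Data.Bool using (true; false; if_then_else_; T)
open import Data.Bool.Properties using (T?; T-∨; T-irrelevant)
open import Data.Fin using (Fin; zero; suc; toℕ; fromℕ<; punchOut)
open import Data.Fin.Properties
  using (any?; pigeonhole; toℕ<n; toℕ≤pred[n]; toℕ-fromℕ<; toℕ-injective; punchOut-injective; punchIn-punchOut)
  renaming (_≟_ to _≟ᶠ_)
open import Data.List using (tabulate)
open import Data.List.Properties using (map-tabulate)
open import Data.Vec.Functional using (Vector; removeAt)
open import Algebra.Properties.CommutativeMonoid.Sum +-0-commutativeMonoid using (sum; sum-remove)
open import Data.Product using (Σ; ∃; ∃₂; _×_; _,_; proj₁; proj₂)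
open import Data.Sum using (_⊎_; inj₁; inj₂; swap; [_,_])
import Data.Sum as Sum
open import Data.Empty using (⊥; ⊥-elim)
open import Data.Unit using (⊤; tt)
open import Function using (_∘_; id)
open import Function.Definitions using (Injective)
open import Function.Bundles using (Inverse; Equivalence; _⇔_; mk⇔; mk↔ₛ′)
open Equivalence using (to; from)
open import Relation.Nullary using (¬_; Dec; yes; no; ¬?; _×-dec_)
open import Relation.Nullary.Decidable using (map′; decidable-stable)
open import Relation.Binary.PropositionalEquality
  using (_≡_; _≢_; refl; sym; trans; cong; subst; subst₂; module ≡-Reasoning)

injection-≤-sum : ∀ {m n} (t : Vector ℕ n) (ι : Fin m → Fin n) → Injective _≡_ _≡_ ι →
                  (∀ j → 1 ≤ t (ι j)) → m ≤ sum t
injection-≤-sum {zero} t ι ι-inj t≥1 = z≤n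
injection-≤-sum {suc m} {zero} t ι _ _ with ι zero
... | ()
injection-≤-sum {suc m} {suc n} t ι ι-inj t≥1 =
  subst (suc m ≤_) (sym (sum-remove {i = ι zero} t))
    (+-mono-≤ (t≥1 zero) (injection-≤-sum (removeAt t (ι zero)) ι′ ι′-inj t′≥1))
  where
  ι0≢ι : ∀ j → ι zero ≢ ι (suc j)
  ι0≢ι j eq with ι-inj eq
  ... | ()
  ι′ : Fin m → Fin n
  ι′ j = punchOut (ι0≢ι j)
  ι′-inj : Injective _≡_ _≡_ ι′
  ι′-inj {i} {j} eq with ι-inj (punchOut-injective (ι0≢ι i) (ι0≢ι j) eq)
  ... | refl = refl
  t′≥1 : ∀ j → 1 ≤ removeAt t (ι zero) (ι′ j)
  t′≥1 j = subst (λ x → 1 ≤ t x) (sym (punchIn-punchOut (ι0≢ι j))) (t≥1 (suc j))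

listSum-tabulate : ∀ {n} (t : Vector ℕ n) → listSum (tabulate t) ≡ sum t
listSum-tabulate {zero} t = refl
listSum-tabulate {suc n} t = cong (t zero +_) (listSum-tabulate (t ∘ suc))

module _ {n : ℕ} (G : Graph n) where

  adjacency-indicator : Fin n → Vector ℕ n
  adjacency-indicator x w = if Adj G x w then 1 else 0

  deg≡sum : ∀ x → deg G x ≡ sum (adjacency-indicator x)
  deg≡sum x = trans (cong listSum (map-tabulate id (adjacency-indicator x)))
                    (listSum-tabulate (adjacency-indicator x))

  deg≤2⇒third-neighbour : ∀ {x a b c} → deg G x ≤ 2 → x ~[ G ] a → x ~[ G ] b → a ≢ b →
                          x ~[ G ] c → c ≡ a ⊎ c ≡ b
  deg≤2⇒third-neighbour {x} {a} {b} {c} deg≤2 xa xb a≢b xc with c ≟ᶠ a | c ≟ᶠ b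
  ... | yes c≡a | _ = inj₁ c≡a
  ... | no _ | yes c≡b = inj₂ c≡b
  ... | no c≢a | no c≢b = ⊥-elim (<-irrefl refl (≤-trans 3≤deg deg≤2))
    where
    ι : Fin 3 → Fin n
    ι zero = a
    ι (suc zero) = b
    ι (suc (suc zero)) = c
    ι-injective : Injective _≡_ _≡_ ι
    ι-injective {zero} {zero} _ = refl
    ι-injective {zero} {suc zero} eq = ⊥-elim (a≢b eq)
    ι-injective {zero} {suc (suc zero)} eq = ⊥-elim (c≢a (sym eq))
    ι-injective {suc zero} {zero} eq = ⊥-elim (a≢b (sym eq))
    ι-injective {suc zero} {suc zero} _ = refl
    ι-injective {suc zero} {suc (suc zero)} eq = ⊥-elim (c≢b (sym eq))
    ι-injective {suc (suc zero)} {zero} eq = ⊥-elim (c≢a eq)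
    ι-injective {suc (suc zero)} {suc zero} eq = ⊥-elim (c≢b eq)
    ι-injective {suc (suc zero)} {suc (suc zero)} _ = refl
    adjacency-indicator≥1 : ∀ {w} → x ~[ G ] w → 1 ≤ adjacency-indicator x w
    adjacency-indicator≥1 {w} x~w with Adj G x w | x~w
    ... | true | _ = s≤s z≤n
    neighbours : ∀ j → 1 ≤ adjacency-indicator x (ι j)
    neighbours zero = adjacency-indicator≥1 xa
    neighbours (suc zero) = adjacency-indicator≥1 xb
    neighbours (suc (suc zero)) = adjacency-indicator≥1 xc
    3≤deg : 3 ≤ deg G x
    3≤deg = subst (3 ≤_) (sym (deg≡sum x)) (injection-≤-sum _ ι ι-injective neighbours)

T-injective : ∀ {a b} → (T a → T b) → (T b → T a) → a ≡ b
T-injective {false} {false} _ _ = refl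
T-injective {false} {true} _ b⇒a = ⊥-elim (b⇒a tt)
T-injective {true} {false} a⇒b _ = ⊥-elim (a⇒b tt)
T-injective {true} {true} _ _ = refl

~-sym : ∀ {n} {G : Graph n} → (∀ x y → Adj G x y ≡ Adj G y x) → ∀ {x y} → x ~[ G ] y → y ~[ G ] x
~-sym G-sym {x} {y} = subst T (G-sym x y)

edge-≡ : ∀ {n} {G : Graph n} {e f : Edge G} → u e ≡ u f → v e ≡ v f → e ≡ f
edge-≡ {e = edge x y x<y x~y} {edge .x .y x<y′ x~y′} refl refl
  rewrite <-irrelevant x<y x<y′ | T-irrelevant x~y x~y′ = refl

edge-flip⇒⊥ : ∀ {n} {G : Graph n} {e f : Edge G} → u e ≡ v f → v e ≡ u f → ⊥
edge-flip⇒⊥ {e = e} {f} refl refl = <-asym (u<v e) (u<v f)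

record Admissible (σ : ℕ → Fin 3) : Set where
  field
    proper    : ∀ i → σ i ≢ σ (suc i)
    no-triple : ∀ i → σ i ≡ σ (2 + i) → σ (2 + i) ≢ σ (4 + i)

mod3 : ℕ → Fin 3
mod3 0 = zero
mod3 1 = suc zero
mod3 2 = suc (suc zero)
mod3 (suc (suc (suc i))) = mod3 i

mod3-≢-1+ : ∀ i → mod3 i ≢ mod3 (1 + i)
mod3-≢-1+ 0 ()
mod3-≢-1+ 1 ()
mod3-≢-1+ 2 ()
mod3-≢-1+ (suc (suc (suc i))) = mod3-≢-1+ i

mod3-≢-2+ : ∀ i → mod3 i ≢ mod3 (2 + i)
mod3-≢-2+ 0 ()
mod3-≢-2+ 1 ()
mod3-≢-2+ 2 ()
mod3-≢-2+ (suc (suc (suc i))) = mod3-≢-2+ i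

mod3-+-multiple : ∀ m i → mod3 (m * 3 + i) ≡ mod3 i
mod3-+-multiple zero i = refl
mod3-+-multiple (suc m) i = mod3-+-multiple m i

mod3-admissible : Admissible mod3
mod3-admissible = record { proper = mod3-≢-1+ ; no-triple = λ i eq _ → mod3-≢-2+ i eq }

mod3-with-jumps-admissible : (δ : ℕ → ℕ) → (∀ i d → d ≤ 4 → δ (d + i) ≡ δ i ⊎ δ (d + i) ≡ suc (δ i)) →
                            Admissible (λ i → mod3 (i + δ i))
mod3-with-jumps-admissible δ δ-step = record { proper = proper ; no-triple = no-triple }
  where
  σ : ℕ → Fin 3
  σ i = mod3 (i + δ i)
  σ-ahead : ∀ i d j → δ (d + i) ≡ j + δ i → σ (d + i) ≡ mod3 ((j + d) + (i + δ i))
  σ-ahead i d j eq = cong mod3 (trans (cong ((d + i) +_) eq) (rearrange d i j (δ i)))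
    where
    rearrange : ∀ d i j x → (d + i) + (j + x) ≡ (j + d) + (i + x)
    rearrange = solve-∀
  proper : ∀ i → σ i ≢ σ (suc i)
  proper i σ₀≡σ₁ with δ-step i 1 (s≤s z≤n)
  ... | inj₁ eq = mod3-≢-1+ (i + δ i) (trans σ₀≡σ₁ (σ-ahead i 1 0 eq))
  ... | inj₂ eq = mod3-≢-2+ (i + δ i) (trans σ₀≡σ₁ (σ-ahead i 1 1 eq))
  no-triple : ∀ i → σ i ≡ σ (2 + i) → σ (2 + i) ≢ σ (4 + i)
  no-triple i σ₀≡σ₂ with δ-step i 2 (s≤s (s≤s z≤n)) | δ-step i 4 ≤-refl | δ-step (2 + i) 2 (s≤s (s≤s z≤n))
  ... | inj₁ eq₂ | _ | _ = ⊥-elim (mod3-≢-2+ (i + δ i) (trans σ₀≡σ₂ (σ-ahead i 2 0 eq₂)))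
  ... | inj₂ eq₂ | inj₂ eq₄ | _ = λ σ₂≡σ₄ →
    mod3-≢-2+ (i + δ i) (trans (sym (σ-ahead i 2 1 eq₂)) (trans σ₂≡σ₄ (σ-ahead i 4 1 eq₄)))
  ... | inj₂ eq₂ | inj₁ eq₄ | inj₁ eq₂₄ = ⊥-elim (m≢1+n+m _ {0} (trans (sym eq₄) (trans eq₂₄ eq₂)))
  ... | inj₂ eq₂ | inj₁ eq₄ | inj₂ eq₂₄ = ⊥-elim (m≢1+n+m _ {1} (trans (sym eq₄) (trans eq₂₄ (cong suc eq₂))))

m≤n≤1+m⇒n≡m⊎n≡1+m : ∀ {m n} → m ≤ n → n ≤ suc m → n ≡ m ⊎ n ≡ suc m
m≤n≤1+m⇒n≡m⊎n≡1+m m≤n n≤1+m with m≤n⇒m<n∨m≡n n≤1+m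
... | inj₁ n<1+m = inj₁ (≤-antisym (s≤s⁻¹ n<1+m) m≤n)
... | inj₂ n≡1+m = inj₂ n≡1+m

m<o⇒[m+n]/o≡n/o⊎1+n/o : ∀ o .{{_ : NonZero o}} m n → m < o → (m + n) / o ≡ n / o ⊎ (m + n) / o ≡ suc (n / o)
m<o⇒[m+n]/o≡n/o⊎1+n/o o m n m<o = m≤n≤1+m⇒n≡m⊎n≡1+m (/-monoˡ-≤ o (m≤n+m n m)) (begin
  (m + n) / o      ≤⟨ /-monoˡ-≤ o (+-monoˡ-≤ n (<⇒≤ m<o)) ⟩
  (o + n) / o      ≡⟨ +-distrib-/-∣ˡ n (∣-refl {o}) ⟩
  o / o + n / o    ≡⟨ cong (_+ n / o) (n/n≡1 o) ⟩
  suc (n / o)      ∎)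
  where open ≤-Reasoning

-- mod3 ⌊(k + b) i / k⌋: per k steps, b evenly spaced skips of a colour.
jumping-mod3 : (k b : ℕ) .{{_ : NonZero k}} → ℕ → Fin 3
jumping-mod3 k b i = mod3 (i + b * i / k)

jumping-mod3-admissible : ∀ k b .{{_ : NonZero k}} → b * 4 < k → Admissible (jumping-mod3 k b)
jumping-mod3-admissible k b b*4<k = mod3-with-jumps-admissible (λ i → b * i / k) jump-step
  where
  jump-step : ∀ i d → d ≤ 4 → b * (d + i) / k ≡ b * i / k ⊎ b * (d + i) / k ≡ suc (b * i / k)
  jump-step i d d≤4 rewrite *-distribˡ-+ b d i =
    m<o⇒[m+n]/o≡n/o⊎1+n/o k (b * d) (b * i) (≤-<-trans (*-monoʳ-≤ b d≤4) b*4<k)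

Periodic : ℕ → (ℕ → Fin 3) → Set
Periodic k σ = ∀ i → σ (i + k) ≡ σ i

periodic-% : ∀ {k σ} .{{_ : NonZero k}} → Periodic k σ → ∀ d m → σ (d + m % k) ≡ σ (d + m)
periodic-% {k} {σ} σ-periodic d m = begin
  σ (d + m % k)                   ≡⟨ periodic-multiple (m / k) (d + m % k) ⟨
  σ (d + m % k + m / k * k)       ≡⟨ cong σ (+-assoc d (m % k) (m / k * k)) ⟩
  σ (d + (m % k + m / k * k))     ≡⟨ cong (λ x → σ (d + x)) (m≡m%n+[m/n]*n m k) ⟨
  σ (d + m)                       ∎
  where
  open ≡-Reasoning
  periodic-multiple : ∀ j x → σ (x + j * k) ≡ σ x
  periodic-multiple zero x = cong σ (+-identityʳ x)
  periodic-multiple (suc j) x =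
    trans (cong σ (sym (+-assoc x k (j * k)))) (trans (periodic-multiple j (x + k)) (σ-periodic x))

jumping-mod3-periodic : ∀ k b m .{{_ : NonZero k}} → k + b ≡ m * 3 → Periodic k (jumping-mod3 k b)
jumping-mod3-periodic k b m k+b≡m*3 i = begin
  mod3 ((i + k) + b * (i + k) / k)  ≡⟨ cong (λ x → mod3 ((i + k) + x)) jumps-per-period ⟩
  mod3 ((i + k) + (b * i / k + b))  ≡⟨ cong mod3 (rearrange i k (b * i / k) b) ⟩
  mod3 ((k + b) + (i + b * i / k))  ≡⟨ cong (λ x → mod3 (x + (i + b * i / k))) k+b≡m*3 ⟩
  mod3 (m * 3 + (i + b * i / k))    ≡⟨ mod3-+-multiple m _ ⟩
  mod3 (i + b * i / k)              ∎
  where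
  open ≡-Reasoning
  rearrange : ∀ i k x b → (i + k) + (x + b) ≡ (k + b) + (i + x)
  rearrange = solve-∀
  jumps-per-period : b * (i + k) / k ≡ b * i / k + b
  jumps-per-period = begin
    b * (i + k) / k        ≡⟨ cong (λ x → x / k) (*-distribˡ-+ b i k) ⟩
    (b * i + b * k) / k    ≡⟨ +-distrib-/-∣ʳ (b * i) (n∣m*n b) ⟩
    b * i / k + b * k / k  ≡⟨ cong (b * i / k +_) (m*n/n≡m b k) ⟩
    b * i / k + b          ∎

cycle-jump-parameters : ∀ k → 3 ≤ k → k ≢ 4 → k ≢ 7 → ∃₂ λ b m → b * 4 < k × k + b ≡ m * 3
cycle-jump-parameters 0 () _ _
cycle-jump-parameters 1 (s≤s ()) _ _
cycle-jump-parameters 2 (s≤s (s≤s ())) _ _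
cycle-jump-parameters 3 _ _ _ = 0 , 1 , s≤s z≤n , refl
cycle-jump-parameters 4 _ k≢4 _ = ⊥-elim (k≢4 refl)
cycle-jump-parameters 5 _ _ _ = 1 , 2 , ≤-refl , refl
cycle-jump-parameters 6 _ _ _ = 0 , 2 , s≤s z≤n , refl
cycle-jump-parameters 7 _ _ k≢7 = ⊥-elim (k≢7 refl)
cycle-jump-parameters (suc (suc (suc (suc (suc (suc (suc (suc j)))))))) _ _ _ = parameters≥8 j
  where
  parameters≥8 : ∀ j → ∃₂ λ b m → b * 4 < 8 + j × (8 + j) + b ≡ m * 3
  parameters≥8 0 = 1 , 3 , m≤m+n 5 3 , refl
  parameters≥8 1 = 0 , 3 , s≤s z≤n , refl
  parameters≥8 2 = 2 , 4 , m≤m+n 9 1 , refl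
  parameters≥8 (suc (suc (suc j))) with parameters≥8 j
  ... | b , m , b*4<8+j , 8+j+b≡m*3 = b , suc m , ≤-trans b*4<8+j (m≤n+m (8 + j) 3) , cong (3 +_) 8+j+b≡m*3

-- The edges of G are the pairs {x , s x} with P x. Vertex x gets colour σ (pos x), and σ-shift
-- says that σ read from s x is σ read from x, one step later.
module SuccessorColouring {n : ℕ} (G : Graph n) (G-sym : ∀ x y → Adj G x y ≡ Adj G y x)
  (s : Fin n → Fin n) (P : Fin n → Set) (P? : ∀ x → Dec (P x))
  (s-injective : ∀ {x y} → P x → P y → s x ≡ s y → x ≡ y)
  (adjacent⇒successor : ∀ {x y} → x ~[ G ] y → (P x × y ≡ s x) ⊎ (P y × x ≡ s y))
  {σ : ℕ → Fin 3} (σ-admissible : Admissible σ)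
  (pos : Fin n → ℕ) (σ-shift : ∀ {x} → P x → ∀ d → σ (d + pos (s x)) ≡ σ (suc d + pos x))
  where

  open Admissible σ-admissible

  Ends : Edge G → Fin n → Set
  Ends e a = (u e ≡ a × v e ≡ s a) ⊎ (v e ≡ a × u e ≡ s a)

  tail : Edge G → Fin n
  tail e with adjacent⇒successor (adj e)
  ... | inj₁ _ = u e
  ... | inj₂ _ = v e

  P-tail : ∀ e → P (tail e)
  P-tail e with adjacent⇒successor (adj e)
  ... | inj₁ (p , _) = p
  ... | inj₂ (p , _) = p

  ends : ∀ e → Ends e (tail e)
  ends e with adjacent⇒successor (adj e)
  ... | inj₁ (_ , v≡su) = inj₁ (refl , v≡su)
  ... | inj₂ (_ , u≡sv) = inj₂ (refl , u≡sv)

  ∈ₑ-tail : ∀ {x} e → x ∈ₑ e → x ≡ tail e ⊎ x ≡ s (tail e)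
  ∈ₑ-tail e x∈e with ends e | x∈e
  ... | inj₁ (u≡a , _) | inj₁ x≡u = inj₁ (trans x≡u u≡a)
  ... | inj₁ (_ , v≡sa) | inj₂ x≡v = inj₂ (trans x≡v v≡sa)
  ... | inj₂ (_ , u≡sa) | inj₁ x≡u = inj₂ (trans x≡u u≡sa)
  ... | inj₂ (v≡a , _) | inj₂ x≡v = inj₁ (trans x≡v v≡a)

  tail∈ₑ : ∀ e → tail e ∈ₑ e
  tail∈ₑ e with ends e
  ... | inj₁ (u≡a , _) = inj₁ (sym u≡a)
  ... | inj₂ (v≡a , _) = inj₂ (sym v≡a)

  s-tail∈ₑ : ∀ e → s (tail e) ∈ₑ e
  s-tail∈ₑ e with ends e
  ... | inj₁ (_ , v≡sa) = inj₂ (sym v≡sa)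
  ... | inj₂ (_ , u≡sa) = inj₁ (sym u≡sa)

  tail~s-tail : ∀ e → tail e ~[ G ] s (tail e)
  tail~s-tail e with ends e
  ... | inj₁ (u≡a , v≡sa) = subst₂ (λ x y → x ~[ G ] y) u≡a v≡sa (adj e)
  ... | inj₂ (v≡a , u≡sa) = subst₂ (λ x y → x ~[ G ] y) v≡a u≡sa (~-sym G-sym (adj e))

  ends-unique : ∀ {e f a} → Ends e a → Ends f a → e ≡ f
  ends-unique (inj₁ (ue , ve)) (inj₁ (uf , vf)) = edge-≡ (trans ue (sym uf)) (trans ve (sym vf))
  ends-unique (inj₂ (ve , ue)) (inj₂ (vf , uf)) = edge-≡ (trans ue (sym uf)) (trans ve (sym vf))
  ends-unique {e} {f} (inj₁ (ue , ve)) (inj₂ (vf , uf)) =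
    ⊥-elim (edge-flip⇒⊥ {e = e} {f} (trans ue (sym vf)) (trans ve (sym uf)))
  ends-unique {e} {f} (inj₂ (ve , ue)) (inj₁ (uf , vf)) =
    ⊥-elim (edge-flip⇒⊥ {e = e} {f} (trans ue (sym vf)) (trans ve (sym uf)))

  tail-injective : ∀ {e f} → tail e ≡ tail f → e ≡ f
  tail-injective {e} {f} a≡b = ends-unique (ends e) (subst (Ends f) (sym a≡b) (ends f))

  Near : Fin n → Fin n → Set
  Near a b = b ≡ a ⊎ b ≡ s a ⊎ a ≡ s b

  share⇒near : ∀ {e f} → Share e f → Near (tail e) (tail f)
  share⇒near {e} {f} (x , x∈e , x∈f) with ∈ₑ-tail e x∈e | ∈ₑ-tail f x∈f
  ... | inj₁ x≡a | inj₁ x≡b = inj₁ (trans (sym x≡b) x≡a)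
  ... | inj₂ x≡sa | inj₁ x≡b = inj₂ (inj₁ (trans (sym x≡b) x≡sa))
  ... | inj₁ x≡a | inj₂ x≡sb = inj₂ (inj₂ (trans (sym x≡a) x≡sb))
  ... | inj₂ x≡sa | inj₂ x≡sb = inj₁ (s-injective (P-tail f) (P-tail e) (trans (sym x≡sb) x≡sa))

  near⇒share : ∀ {e f} → Near (tail e) (tail f) → Share e f
  near⇒share {e} {f} (inj₁ b≡a) = tail e , tail∈ₑ e , subst (_∈ₑ f) b≡a (tail∈ₑ f)
  near⇒share {e} {f} (inj₂ (inj₁ b≡sa)) = s (tail e) , s-tail∈ₑ e , subst (_∈ₑ f) b≡sa (tail∈ₑ f)
  near⇒share {e} {f} (inj₂ (inj₂ a≡sb)) = tail e , tail∈ₑ e , subst (_∈ₑ f) (sym a≡sb) (s-tail∈ₑ f)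

  TwoApart : Fin n → Fin n → Set
  TwoApart a b = (P (s a) × b ≡ s (s a)) ⊎ (P (s b) × a ≡ s (s b))

  near-near⇒two-apart : ∀ {a b c} → P a → P b → P c → ¬ Near a b → Near a c → Near c b → TwoApart a b
  near-near⇒two-apart _ _ _ ¬ab (inj₁ refl) cb = ⊥-elim (¬ab cb)
  near-near⇒two-apart _ _ _ ¬ab (inj₂ (inj₁ refl)) (inj₁ refl) = ⊥-elim (¬ab (inj₂ (inj₁ refl)))
  near-near⇒two-apart _ _ pc _ (inj₂ (inj₁ refl)) (inj₂ (inj₁ refl)) = inj₁ (pc , refl)
  near-near⇒two-apart pa pb _ ¬ab (inj₂ (inj₁ refl)) (inj₂ (inj₂ sa≡sb)) =
    ⊥-elim (¬ab (inj₁ (sym (s-injective pa pb sa≡sb))))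
  near-near⇒two-apart _ _ _ ¬ab (inj₂ (inj₂ refl)) (inj₁ refl) = ⊥-elim (¬ab (inj₂ (inj₂ refl)))
  near-near⇒two-apart _ _ _ ¬ab (inj₂ (inj₂ refl)) (inj₂ (inj₁ refl)) = ⊥-elim (¬ab (inj₁ refl))
  near-near⇒two-apart _ _ pc _ (inj₂ (inj₂ refl)) (inj₂ (inj₂ refl)) = inj₂ (pc , refl)

  dist2⇒two-apart : ∀ {e f} → Dist2 e f → TwoApart (tail e) (tail f)
  dist2⇒two-apart {e} {f} (_ , ¬share , g , e~g , g~f) =
    near-near⇒two-apart (P-tail e) (P-tail f) (P-tail g) (¬share ∘ near⇒share) (share⇒near e~g) (share⇒near g~f)

  κ : Fin n → Fin 3
  κ x = σ (pos x)

  σ-shift₂ : ∀ {x} → P x → P (s x) → ∀ d → σ (d + pos (s (s x))) ≡ σ (2 + d + pos x)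
  σ-shift₂ px psx d = trans (σ-shift psx d) (σ-shift px (suc d))

  κ-proper : ∀ {x} → P x → κ x ≢ κ (s x)
  κ-proper px eq = proper _ (trans eq (σ-shift px 0))

  κ-no-triple : ∀ {x y} → P x → P (s x) → P y → P (s y) → y ≡ s (s x) →
                κ x ≡ κ y → κ y ≢ κ (s (s y))
  κ-no-triple p₀ p₁ p₂ p₃ refl eq₀₂ eq₂₄ =
    no-triple _ (trans eq₀₂ κ₂) (trans (sym κ₂) (trans eq₂₄ (trans (σ-shift₂ p₂ p₃ 0) (σ-shift₂ p₀ p₁ 2))))
    where κ₂ = σ-shift₂ p₀ p₁ 0

  colour : EdgeColoring G 3
  colour e = κ (tail e)

  two-apart-unique : ∀ {a b c} → P a → P b → P c → TwoApart a b → TwoApart a c →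
                     κ b ≡ κ a → κ c ≡ κ a → b ≡ c
  two-apart-unique _ _ _ (inj₁ (_ , refl)) (inj₁ (_ , refl)) _ _ = refl
  two-apart-unique _ pb pc (inj₂ (psb , refl)) (inj₂ (psc , ssb≡ssc)) _ _ =
    s-injective pb pc (s-injective psb psc ssb≡ssc)
  two-apart-unique pa _ pc (inj₁ (psa , refl)) (inj₂ (psc , refl)) κb κc =
    ⊥-elim (κ-no-triple pc psc pa psa refl κc (sym κb))
  two-apart-unique pa pb _ (inj₂ (psb , refl)) (inj₁ (psa , refl)) κb κc =
    ⊥-elim (κ-no-triple pb psb pa psa refl κb (sym κc))

  zero-one : ZeroOne colour
  zero-one = dist1 , dist2
    where
    dist1 : ∀ e f → Dist1 e f → colour e ≢ colour f
    dist1 e f (e≢f , share) eq with share⇒near share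
    ... | inj₁ b≡a = e≢f (tail-injective (sym b≡a))
    ... | inj₂ (inj₁ b≡sa) = κ-proper (P-tail e) (trans eq (cong κ b≡sa))
    ... | inj₂ (inj₂ a≡sb) = κ-proper (P-tail f) (trans (sym eq) (cong κ a≡sb))
    dist2 : ∀ e f g → Dist2 e f → colour f ≡ colour e → Dist2 e g → colour g ≡ colour e → f ≡ g
    dist2 e f g ef κf eg κg = tail-injective
      (two-apart-unique (P-tail e) (P-tail f) (P-tail g) (dist2⇒two-apart ef) (dist2⇒two-apart eg) κf κg)

  deg-one-at-tail : ∀ e → P (s (tail e)) → κ (s (s (tail e))) ≡ κ (tail e) →
                    DegOneInVM colour (colour e) (tail e)
  deg-one-at-tail e psa κ₂≡κ₀ = s (tail e) , (tail~s-tail e , e , refl , s-tail∈ₑ e) , unique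
    where
    unique : ∀ w → tail e ~[ G ] w → InVM colour (colour e) w → w ≡ s (tail e)
    unique w a~w (f , κf , w∈f) with adjacent⇒successor a~w | ∈ₑ-tail f w∈f
    ... | inj₁ (_ , w≡sa) | _ = w≡sa
    ... | inj₂ (pw , a≡sw) | inj₁ w≡b =
      ⊥-elim (κ-proper pw (trans (cong κ w≡b) (trans κf (cong κ a≡sw))))
    ... | inj₂ (pw , a≡sw) | inj₂ w≡sb =
      ⊥-elim (κ-no-triple (P-tail f) (subst P w≡sb pw) (P-tail e) psa (trans a≡sw (cong s w≡sb)) κf (sym κ₂≡κ₀))

  deg-one-at-s-tail : ∀ e → ¬ (P (s (tail e)) × κ (s (s (tail e))) ≡ κ (tail e)) →
                      DegOneInVM colour (colour e) (s (tail e))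
  deg-one-at-s-tail e ¬H = tail e , (~-sym G-sym (tail~s-tail e) , e , refl , tail∈ₑ e) , unique
    where
    unique : ∀ w → s (tail e) ~[ G ] w → InVM colour (colour e) w → w ≡ tail e
    unique w sa~w (f , κf , w∈f) with adjacent⇒successor sa~w | ∈ₑ-tail f w∈f
    ... | inj₂ (pw , sa≡sw) | _ = s-injective pw (P-tail e) (sym sa≡sw)
    ... | inj₁ (psa , w≡ssa) | inj₁ w≡b = ⊥-elim (¬H (psa , trans (cong κ (trans (sym w≡ssa) w≡b)) κf))
    ... | inj₁ (psa , w≡ssa) | inj₂ w≡sb =
      ⊥-elim (κ-proper (P-tail e) (trans (sym κf) (cong κ b≡sa)))
      where b≡sa = s-injective (P-tail f) psa (trans (sym w≡sb) w≡ssa)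

  ∈ₑ-endpoint : ∀ (Q : Fin n → Set) {x} (e : Edge G) → x ∈ₑ e → Q x → Q (u e) ⊎ Q (v e)
  ∈ₑ-endpoint Q e (inj₁ refl) q = inj₁ q
  ∈ₑ-endpoint Q e (inj₂ refl) q = inj₂ q

  semistrong : Semistrong colour
  semistrong e with P? (s (tail e)) | κ (s (s (tail e))) ≟ᶠ κ (tail e)
  ... | yes psa | yes eq = at-endpoint (tail∈ₑ e) (deg-one-at-tail e psa eq)
    where at-endpoint = ∈ₑ-endpoint (DegOneInVM colour (colour e)) e
  ... | no ¬psa | _ = at-endpoint (s-tail∈ₑ e) (deg-one-at-s-tail e (¬psa ∘ proj₁))
    where at-endpoint = ∈ₑ-endpoint (DegOneInVM colour (colour e)) e
  ... | yes _ | no neq = at-endpoint (s-tail∈ₑ e) (deg-one-at-s-tail e (neq ∘ proj₂))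
    where at-endpoint = ∈ₑ-endpoint (DegOneInVM colour (colour e)) e

  colourable : SSColorable G 3 × ZeroOneColorable G 3
  colourable = (colour , semistrong) , (colour , zero-one)

module _ {k : ℕ} .{{_ : NonZero k}} where

  succ : Fin k → Fin k
  succ i = fromℕ< (m%n<n (toℕ i + 1) k)

  toℕ-succ : ∀ i → toℕ (succ i) ≡ (toℕ i + 1) % k
  toℕ-succ i = toℕ-fromℕ< _

  [1+i]%k-cases : ∀ {i} → i < k → (suc i < k × (i + 1) % k ≡ suc i) ⊎ (suc i ≡ k × (i + 1) % k ≡ 0)
  [1+i]%k-cases {i} i<k with m≤n⇒m<n∨m≡n i<k
  ... | inj₁ 1+i<k = inj₁ (1+i<k , trans (cong (_% k) (+-comm i 1)) (m<n⇒m%n≡m 1+i<k))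
  ... | inj₂ 1+i≡k = inj₂ (1+i≡k , trans (cong (_% k) (trans (+-comm i 1) 1+i≡k)) (n%n≡0 k))

  [1+i]%k-injective : ∀ {i j} → i < k → j < k → (i + 1) % k ≡ (j + 1) % k → i ≡ j
  [1+i]%k-injective i<k j<k eq with [1+i]%k-cases i<k | [1+i]%k-cases j<k
  ... | inj₁ (_ , ei) | inj₁ (_ , ej) = suc-injective (trans (sym ei) (trans eq ej))
  ... | inj₂ (1+i≡k , _) | inj₂ (1+j≡k , _) = suc-injective (trans 1+i≡k (sym 1+j≡k))
  ... | inj₁ (_ , ei) | inj₂ (_ , ej) with () ← trans (sym ei) (trans eq ej)
  ... | inj₂ (_ , ei) | inj₁ (_ , ej) with () ← trans (sym ej) (trans (sym eq) ei)

  succ-injective : ∀ {i j} → succ i ≡ succ j → i ≡ j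
  succ-injective {i} {j} eq = toℕ-injective ([1+i]%k-injective (toℕ<n i) (toℕ<n j)
    (trans (sym (toℕ-succ i)) (trans (cong toℕ eq) (toℕ-succ j))))

  cycle-adjacent⇒succ : ∀ {i j} → i ~[ cycle k ] j → j ≡ succ i ⊎ i ≡ succ j
  cycle-adjacent⇒succ {i} {j} i~j with to T-∨ i~j
  ... | inj₁ j≡1+i = inj₁ (toℕ-injective (trans (≡ᵇ⇒≡ _ _ j≡1+i) (sym (toℕ-succ i))))
  ... | inj₂ i≡1+j = inj₂ (toℕ-injective (trans (≡ᵇ⇒≡ _ _ i≡1+j) (sym (toℕ-succ j))))

cycle-colourable : ∀ {n k} .{{_ : NonZero k}} (G : Graph n) → Simple G → Iso G (cycle k) →
                   ∀ {σ} → Admissible σ → Periodic k σ → SSColorable G 3 × ZeroOneColorable G 3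
cycle-colourable {n} {k} G (G-sym , _) (f , adj-preserved) {σ} σ-admissible σ-periodic =
  SuccessorColouring.colourable G G-sym s (λ _ → ⊤) (λ _ → yes tt) (λ _ _ → s-injective)
    adjacent⇒successor σ-admissible pos (λ _ → σ-shift)
  where
  open Inverse f using (strictlyInverseˡ; strictlyInverseʳ) renaming (to to index; from to vertex-at)
  pos : Fin n → ℕ
  pos x = toℕ (index x)
  s : Fin n → Fin n
  s x = vertex-at (succ (index x))
  index-s : ∀ x → index (s x) ≡ succ (index x)
  index-s x = strictlyInverseˡ (succ (index x))
  s-injective : ∀ {x y} → s x ≡ s y → x ≡ y
  s-injective {x} {y} eq = begin
    x                    ≡⟨ strictlyInverseʳ x ⟨
    vertex-at (index x)  ≡⟨ cong vertex-at (succ-injective succ-eq) ⟩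
    vertex-at (index y)  ≡⟨ strictlyInverseʳ y ⟩
    y                    ∎
    where
    open ≡-Reasoning
    succ-eq : succ (index x) ≡ succ (index y)
    succ-eq = trans (sym (index-s x)) (trans (cong index eq) (index-s y))
  adjacent⇒successor : ∀ {x y} → x ~[ G ] y → (⊤ × y ≡ s x) ⊎ (⊤ × x ≡ s y)
  adjacent⇒successor {x} {y} x~y with cycle-adjacent⇒succ (subst T (adj-preserved x y) x~y)
  ... | inj₁ eq = inj₁ (tt , trans (sym (strictlyInverseʳ y)) (cong vertex-at eq))
  ... | inj₂ eq = inj₂ (tt , trans (sym (strictlyInverseʳ x)) (cong vertex-at eq))
  σ-shift : ∀ {x} d → σ (d + pos (s x)) ≡ σ (suc d + pos x)
  σ-shift {x} d = begin
    σ (d + pos (s x))             ≡⟨ cong (λ i → σ (d + toℕ i)) (index-s x) ⟩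
    σ (d + toℕ (succ (index x)))  ≡⟨ cong (λ i → σ (d + i)) (toℕ-succ (index x)) ⟩
    σ (d + (pos x + 1) % k)       ≡⟨ periodic-% σ-periodic d (pos x + 1) ⟩
    σ (d + (pos x + 1))           ≡⟨ cong σ (rearrange d (pos x)) ⟩
    σ (suc d + pos x)             ∎
    where
    open ≡-Reasoning
    rearrange : ∀ d i → d + (i + 1) ≡ suc d + i
    rearrange = solve-∀

module MaxDegreeTwo {n : ℕ} (G : Graph n) (G-simple : Simple G) (deg≤2 : ∀ x → deg G x ≤ 2) where

  G-sym : ∀ x y → Adj G x y ≡ Adj G y x
  G-sym = proj₁ G-simple

  ~-irrefl : ∀ {x} → ¬ x ~[ G ] x
  ~-irrefl {x} = subst T (proj₂ G-simple x)

  record Path (r : Fin n) : Set where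
    field
      last      : ℕ
      vertex    : ℕ → Fin n
      injective : ∀ {i j} → i ≤ last → j ≤ last → vertex i ≡ vertex j → i ≡ j
      linked    : ∀ {i} → i < last → vertex i ~[ G ] vertex (suc i)
      ends-at   : vertex last ≡ r

    OnPath : Fin n → Set
    OnPath w = ∃ λ i → i ≤ last × vertex i ≡ w

    on-path? : ∀ w → Dec (OnPath w)
    on-path? w = map′ (λ (i , i<1+last , eq) → i , s≤s⁻¹ i<1+last , eq)
                      (λ (i , i≤last , eq) → i , s≤s i≤last , eq)
                      (anyUpTo? (λ i → vertex i ≟ᶠ w) (suc last))

    HeadClosed : Set
    HeadClosed = ∀ w → vertex 0 ~[ G ] w → OnPath w

    last<n : last < n
    last<n with n ≤? last
    ... | no n≰last = ≰⇒> n≰last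
    ... | yes n≤last with i , j , i<j , eq ← pigeonhole (s≤s n≤last) (λ i → vertex (toℕ i)) =
      ⊥-elim (<-irrefl (injective (toℕ≤pred[n] i) (toℕ≤pred[n] j) eq) i<j)

  open Path

  extend : ∀ {r} (p : Path r) {w} → vertex p 0 ~[ G ] w → ¬ OnPath p w → Path r
  extend {r} p {w} h~w w∉p = record
    { last = suc (last p)
    ; vertex = vertex′
    ; injective = injective′
    ; linked = linked′
    ; ends-at = ends-at p
    }
    where
    vertex′ : ℕ → Fin n
    vertex′ zero = w
    vertex′ (suc i) = vertex p i
    injective′ : ∀ {i j} → i ≤ suc (last p) → j ≤ suc (last p) → vertex′ i ≡ vertex′ j → i ≡ j
    injective′ {zero} {zero} _ _ _ = refl
    injective′ {zero} {suc j} _ (s≤s j≤last) eq = ⊥-elim (w∉p (j , j≤last , sym eq))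
    injective′ {suc i} {zero} (s≤s i≤last) _ eq = ⊥-elim (w∉p (i , i≤last , eq))
    injective′ {suc i} {suc j} (s≤s i≤last) (s≤s j≤last) eq = cong suc (injective p i≤last j≤last eq)
    linked′ : ∀ {i} → i < suc (last p) → vertex′ i ~[ G ] vertex′ (suc i)
    linked′ {zero} _ = ~-sym G-sym h~w
    linked′ {suc i} (s≤s i<last) = linked p i<last

  grow : ∀ {r} fuel (p : Path r) → n ≤ last p + fuel → Σ (Path r) HeadClosed
  grow zero p n≤last+0 = ⊥-elim (<-irrefl refl (<-≤-trans (last<n p) (subst (n ≤_) (+-identityʳ _) n≤last+0)))
  grow (suc fuel) p n≤last+1+fuel with any? (λ w → T? (Adj G (vertex p 0) w) ×-dec ¬? (on-path? p w))
  ... | yes (w , h~w , w∉p) =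
    grow fuel (extend p h~w w∉p) (subst (n ≤_) (+-suc (last p) fuel) n≤last+1+fuel)
  ... | no ∄w = p , λ w h~w → decidable-stable (on-path? p w) (λ w∉p → ∄w (w , h~w , w∉p))

  maximal-path : ∀ r → Σ (Path r) HeadClosed
  maximal-path r = grow n trivial ≤-refl
    where
    trivial : Path r
    trivial = record
      { last = 0 ; vertex = λ _ → r ; injective = λ { z≤n z≤n _ → refl } ; linked = λ () ; ends-at = refl }

  module HeadClosedPath {r} (p : Path r) (closed : HeadClosed p) where

    Closing : ℕ → ℕ → Set
    Closing i j = i ≡ last p × j ≡ 0 × 2 ≤ last p

    Follows : ℕ → ℕ → Set
    Follows i j = j ≡ suc i ⊎ Closing i j

    interior-neighbour : ∀ {i y} → suc i < last p → vertex p (suc i) ~[ G ] y →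
                         y ≡ vertex p i ⊎ y ≡ vertex p (2 + i)
    interior-neighbour {i} 1+i<last h =
      deg≤2⇒third-neighbour G (deg≤2 _) (~-sym G-sym (linked p (m+n≤o⇒n≤o 1 1+i<last))) (linked p 1+i<last)
        (λ eq → m≢1+n+m i {1} (injective p (m+n≤o⇒n≤o 2 1+i<last) 1+i<last eq)) h

    head-neighbour : ∀ {j} → j ≤ last p → vertex p 0 ~[ G ] vertex p j → j ≡ 1 ⊎ (j ≡ last p × 2 ≤ j)
    head-neighbour {zero} _ h = ⊥-elim (~-irrefl h)
    head-neighbour {suc zero} _ _ = inj₁ refl
    head-neighbour {suc (suc j)} j≤last h with suc (suc j) <? last p
    ... | no j≮last = inj₂ (≤-antisym j≤last (≮⇒≥ j≮last) , s≤s (s≤s z≤n))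
    ... | yes j<last with interior-neighbour {suc j} j<last (~-sym G-sym h)
    ...   | inj₁ eq with () ← injective p z≤n (<⇒≤ (m+n≤o⇒n≤o 1 j<last)) eq
    ...   | inj₂ eq with () ← injective p z≤n j<last eq

    adjacent-positions-< : ∀ {i j} → i < last p → j ≤ last p → vertex p i ~[ G ] vertex p j →
                           Follows i j ⊎ Follows j i
    adjacent-positions-< {zero} _ j≤last h with head-neighbour j≤last h
    ... | inj₁ refl = inj₁ (inj₁ refl)
    ... | inj₂ (refl , 2≤j) = inj₂ (inj₂ (refl , refl , 2≤j))
    adjacent-positions-< {suc i} 1+i<last j≤last h with interior-neighbour 1+i<last h
    ... | inj₁ eq = inj₂ (inj₁ (cong suc (sym (injective p j≤last (m+n≤o⇒n≤o 2 1+i<last) eq))))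
    ... | inj₂ eq = inj₁ (inj₁ (injective p j≤last 1+i<last eq))

    adjacent-positions : ∀ {i j} → i ≤ last p → j ≤ last p → vertex p i ~[ G ] vertex p j →
                         Follows i j ⊎ Follows j i
    adjacent-positions i≤last j≤last h with m≤n⇒m<n∨m≡n i≤last | m≤n⇒m<n∨m≡n j≤last
    ... | inj₁ i<last | _ = adjacent-positions-< i<last j≤last h
    ... | inj₂ _ | inj₁ j<last = swap (adjacent-positions-< j<last i≤last (~-sym G-sym h))
    ... | inj₂ refl | inj₂ refl = ⊥-elim (~-irrefl h)

    TailClosed : Set
    TailClosed = ∀ w → vertex p (last p) ~[ G ] w → OnPath p w

    pred-last~last : 0 < last p → vertex p (pred (last p)) ~[ G ] vertex p (last p)
    pred-last~last 0<last = subst (λ j → vertex p (pred (last p)) ~[ G ] vertex p j) (suc-pred (last p))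
                                  (linked p (≤-reflexive (suc-pred (last p))))
      where instance _ = >-nonZero 0<last

    endpoint⇒tail-closed : ∀ {a} → (∀ w → r ~[ G ] w → w ≡ a) → TailClosed
    endpoint⇒tail-closed {a} only-a w h with last p ≟ 0
    ... | yes last≡0 = closed w (subst (λ j → vertex p j ~[ G ] w) last≡0 h)
    ... | no last≢0 = pred (last p) , pred[n]≤n , trans (only-a′ pred-last~) (sym (only-a′ h))
      where
      only-a′ : ∀ {w} → vertex p (last p) ~[ G ] w → w ≡ a
      only-a′ {w} = only-a w ∘ subst (λ x → x ~[ G ] w) (ends-at p)
      pred-last~ : vertex p (last p) ~[ G ] vertex p (pred (last p))
      pred-last~ = ~-sym G-sym (pred-last~last (n≢0⇒n>0 last≢0))

    second-head-neighbour⇒tail-closed : ∀ {w} → vertex p 0 ~[ G ] w → w ≢ vertex p 1 → TailClosed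
    second-head-neighbour⇒tail-closed {w} h~w w≢v₁ y last~y with closed w h~w
    ... | j , j≤last , refl with head-neighbour j≤last h~w
    ...   | inj₁ refl = ⊥-elim (w≢v₁ refl)
    ...   | inj₂ (refl , 2≤last)
      with deg≤2⇒third-neighbour G (deg≤2 _) (~-sym G-sym (pred-last~last (<-trans (s≤s z≤n) 2≤last)))
                                 (~-sym G-sym h~w) pred≢0 last~y
      where
      pred≢0 : vertex p (pred (last p)) ≢ vertex p 0
      pred≢0 eq with () ← subst (1 ≤_) (injective p pred[n]≤n z≤n eq) (pred-mono-≤ 2≤last)
    ...     | inj₁ y≡pred = pred (last p) , pred[n]≤n , sym y≡pred
    ...     | inj₂ y≡v₀ = 0 , z≤n , sym y≡v₀

    neighbour-on-path : TailClosed → ∀ {x w} → OnPath p x → x ~[ G ] w → OnPath p w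
    neighbour-on-path _ (zero , _ , refl) h = closed _ h
    neighbour-on-path tail-closed (suc i , 1+i≤last , refl) h with m≤n⇒m<n∨m≡n 1+i≤last
    ... | inj₂ 1+i≡last = tail-closed _ (subst (λ j → vertex p j ~[ G ] _) 1+i≡last h)
    ... | inj₁ 1+i<last with interior-neighbour 1+i<last h
    ...   | inj₁ w≡vᵢ = i , <⇒≤ 1+i≤last , sym w≡vᵢ
    ...   | inj₂ w≡v₂₊ᵢ = 2 + i , 1+i<last , sym w≡v₂₊ᵢ

    tail-closed⇒spanning : Connected G → TailClosed → ∀ x → OnPath p x
    tail-closed⇒spanning connected tail-closed x = reach (0 , z≤n , refl) (connected (vertex p 0) x)
      where
      reach : ∀ {y z} → OnPath p y → Walk G y z → OnPath p z
      reach on-y here = on-y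
      reach on-y (step y~y′ walk) = reach (neighbour-on-path tail-closed on-y y~y′) walk

  module _ (connected : Connected G) where

    spanning-path-from-endpoint : ∀ {r a} → (∀ w → r ~[ G ] w → w ≡ a) →
                                  Σ (Path r) λ p → HeadClosed p × (∀ x → OnPath p x)
    spanning-path-from-endpoint {r} only-a with p , closed ← maximal-path r =
      p , closed , tail-closed⇒spanning connected (endpoint⇒tail-closed only-a)
      where open HeadClosedPath p closed

    -- Grow a path at its head. A second neighbour of the head closes a cycle; otherwise the head
    -- is an endpoint, and a path grown from it spans G.
    spanning-path : Fin n → ∃₂ λ r (p : Path r) → HeadClosed p × (∀ x → OnPath p x)
    spanning-path v with p , closed ← maximal-path v
                    | any? (λ w → T? (Adj G (vertex p 0) w) ×-dec ¬? (w ≟ᶠ vertex p 1))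
    ... | yes (w , h~w , w≢v₁) =
      v , p , closed , tail-closed⇒spanning connected (second-head-neighbour⇒tail-closed h~w w≢v₁)
      where open HeadClosedPath p closed
    ... | no ∄w = vertex p 0 , spanning-path-from-endpoint λ w h~w →
      decidable-stable (w ≟ᶠ vertex p 1) (λ w≢v₁ → ∄w (w , h~w , w≢v₁))

  module SpanningPath {r} (p : Path r) (closed : HeadClosed p) (spanning : ∀ x → OnPath p x) where

    open HeadClosedPath p closed

    pos : Fin n → ℕ
    pos x = proj₁ (spanning x)

    pos≤last : ∀ x → pos x ≤ last p
    pos≤last x = proj₁ (proj₂ (spanning x))

    vertex-pos : ∀ x → vertex p (pos x) ≡ x
    vertex-pos x = proj₂ (proj₂ (spanning x))

    pos-vertex : ∀ {i} → i ≤ last p → pos (vertex p i) ≡ i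
    pos-vertex i≤last = injective p (pos≤last _) i≤last (vertex-pos _)

    at-positions : ∀ {x y} → x ~[ G ] y → vertex p (pos x) ~[ G ] vertex p (pos y)
    at-positions {x} {y} = subst₂ (λ x y → x ~[ G ] y) (sym (vertex-pos x)) (sym (vertex-pos y))

    via-positions : ∀ {x y} → vertex p (pos x) ~[ G ] vertex p (pos y) → x ~[ G ] y
    via-positions {x} {y} = subst₂ (λ x y → x ~[ G ] y) (vertex-pos x) (vertex-pos y)

    adjacent⇒follows : ∀ {x y} → x ~[ G ] y → Follows (pos x) (pos y) ⊎ Follows (pos y) (pos x)
    adjacent⇒follows {x} {y} x~y = adjacent-positions (pos≤last x) (pos≤last y) (at-positions x~y)

    ClosingEdge : Set
    ClosingEdge = 2 ≤ last p × vertex p (last p) ~[ G ] vertex p 0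

    closing⇒closing-edge : ∀ {x y} → Closing (pos x) (pos y) → x ~[ G ] y → ClosingEdge
    closing⇒closing-edge {x} {y} (i≡last , j≡0 , 2≤last) x~y =
      2≤last , subst₂ (λ i j → vertex p i ~[ G ] vertex p j) i≡last j≡0 (at-positions x~y)

    path-colourable : ¬ ClosingEdge → SSColorable G 3 × ZeroOneColorable G 3
    path-colourable no-closing-edge =
      SuccessorColouring.colourable G G-sym s P (λ x → pos x <? last p) s-injective
        adjacent⇒successor mod3-admissible pos σ-shift
      where
      s : Fin n → Fin n
      s x = vertex p (suc (pos x))
      P : Fin n → Set
      P x = pos x < last p
      pos-s : ∀ {x} → P x → pos (s x) ≡ suc (pos x)
      pos-s = pos-vertex
      s-injective : ∀ {x y} → P x → P y → s x ≡ s y → x ≡ y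
      s-injective {x} {y} px py eq = begin
        x                  ≡⟨ vertex-pos x ⟨
        vertex p (pos x)   ≡⟨ cong (vertex p) (suc-injective 1+i≡1+j) ⟩
        vertex p (pos y)   ≡⟨ vertex-pos y ⟩
        y                  ∎
        where
        open ≡-Reasoning
        1+i≡1+j : suc (pos x) ≡ suc (pos y)
        1+i≡1+j = trans (sym (pos-s px)) (trans (cong pos eq) (pos-s py))
      successor : ∀ {x y} → pos y ≡ suc (pos x) → P x × y ≡ s x
      successor {x} {y} j≡1+i =
        subst (_≤ last p) j≡1+i (pos≤last y) , trans (sym (vertex-pos y)) (cong (vertex p) j≡1+i)
      adjacent⇒successor : ∀ {x y} → x ~[ G ] y → (P x × y ≡ s x) ⊎ (P y × x ≡ s y)
      adjacent⇒successor x~y with adjacent⇒follows x~y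
      ... | inj₁ (inj₁ j≡1+i) = inj₁ (successor j≡1+i)
      ... | inj₂ (inj₁ i≡1+j) = inj₂ (successor i≡1+j)
      ... | inj₁ (inj₂ closing) = ⊥-elim (no-closing-edge (closing⇒closing-edge closing x~y))
      ... | inj₂ (inj₂ closing) = ⊥-elim (no-closing-edge (closing⇒closing-edge closing (~-sym G-sym x~y)))
      σ-shift : ∀ {x} → P x → ∀ d → mod3 (d + pos (s x)) ≡ mod3 (suc d + pos x)
      σ-shift {x} px d = cong mod3 (trans (cong (d +_) (pos-s px)) (+-suc d (pos x)))

    follows⇔[1+i]%k : ∀ {i j} → 2 ≤ last p → i ≤ last p → j ≤ last p → Follows i j ⇔ j ≡ (i + 1) % suc (last p)
    follows⇔[1+i]%k {i} {j} 2≤last i≤last j≤last = mk⇔ follows⇒ ⇒follows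
      where
      follows⇒ : Follows i j → j ≡ (i + 1) % suc (last p)
      follows⇒ follows with [1+i]%k-cases (s≤s i≤last) | follows
      ... | inj₁ (_ , [1+i]%k≡1+i) | inj₁ j≡1+i = trans j≡1+i (sym [1+i]%k≡1+i)
      ... | inj₁ (1+i<k , _) | inj₂ (refl , _) = ⊥-elim (<-irrefl refl 1+i<k)
      ... | inj₂ (1+i≡k , _) | inj₁ refl = ⊥-elim (<-irrefl refl (subst (_≤ last p) 1+i≡k j≤last))
      ... | inj₂ (_ , [1+i]%k≡0) | inj₂ (_ , j≡0 , _) = trans j≡0 (sym [1+i]%k≡0)
      ⇒follows : j ≡ (i + 1) % suc (last p) → Follows i j
      ⇒follows j≡[1+i]%k with [1+i]%k-cases (s≤s i≤last)
      ... | inj₁ (_ , [1+i]%k≡1+i) = inj₁ (trans j≡[1+i]%k [1+i]%k≡1+i)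
      ... | inj₂ (1+i≡k , [1+i]%k≡0) = inj₂ (suc-injective 1+i≡k , trans j≡[1+i]%k [1+i]%k≡0 , 2≤last)

    cycle-iso : ClosingEdge → Iso G (cycle (suc (last p)))
    cycle-iso (2≤last , closing-edge) =
      mk↔ₛ′ index vertex-at index-vertex-at vertex-at-index , adjacency-preserved
      where
      index : Fin n → Fin (suc (last p))
      index x = fromℕ< (s≤s (pos≤last x))
      vertex-at : Fin (suc (last p)) → Fin n
      vertex-at i = vertex p (toℕ i)
      toℕ-index : ∀ x → toℕ (index x) ≡ pos x
      toℕ-index x = toℕ-fromℕ< _
      index-vertex-at : ∀ i → index (vertex-at i) ≡ i
      index-vertex-at i = toℕ-injective (trans (toℕ-index _) (pos-vertex (toℕ≤pred[n] i)))
      vertex-at-index : ∀ x → vertex-at (index x) ≡ x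
      vertex-at-index x = trans (cong (vertex p) (toℕ-index x)) (vertex-pos x)
      follows⇒adjacent : ∀ {x y} → Follows (pos x) (pos y) → x ~[ G ] y
      follows⇒adjacent {x} {y} (inj₁ j≡1+i) =
        via-positions (subst (λ j → vertex p (pos x) ~[ G ] vertex p j) (sym j≡1+i)
                             (linked p (subst (_≤ last p) j≡1+i (pos≤last y))))
      follows⇒adjacent {x} {y} (inj₂ (i≡last , j≡0 , _)) =
        via-positions (subst₂ (λ i j → vertex p i ~[ G ] vertex p j) (sym i≡last) (sym j≡0) closing-edge)
      follows⇔ᵇ : ∀ x y → Follows (pos x) (pos y) ⇔ T (toℕ (index y) ≡ᵇ (toℕ (index x) + 1) % suc (last p))
      follows⇔ᵇ x y rewrite toℕ-index x | toℕ-index y = mk⇔ (≡⇒≡ᵇ _ _ ∘ to follows⇔) (from follows⇔ ∘ ≡ᵇ⇒≡ _ _)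
        where follows⇔ = follows⇔[1+i]%k 2≤last (pos≤last x) (pos≤last y)
      adjacency-preserved : ∀ x y → Adj G x y ≡ Adj (cycle (suc (last p))) (index x) (index y)
      adjacency-preserved x y = T-injective
        (λ x~y → from T-∨ (Sum.map (to (follows⇔ᵇ x y)) (to (follows⇔ᵇ y x)) (adjacent⇒follows x~y)))
        (λ x~y → [ follows⇒adjacent ∘ from (follows⇔ᵇ x y)
                 , ~-sym G-sym ∘ follows⇒adjacent ∘ from (follows⇔ᵇ y x) ] (to T-∨ x~y))

  path-colourable-or-cycle : Connected G → Fin n →
    (SSColorable G 3 × ZeroOneColorable G 3) ⊎ (∃ λ last → 2 ≤ last × Iso G (cycle (suc last)))
  path-colourable-or-cycle connected v with _ , p , closed , spanning ← spanning-path connected v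
                                       with 2 ≤? last p ×-dec T? (Adj G (vertex p (last p)) (vertex p 0))
  ... | no no-closing-edge = inj₁ (path-colourable no-closing-edge)
    where open SpanningPath p closed spanning
  ... | yes closing-edge = inj₂ (last p , proj₁ closing-edge , cycle-iso closing-edge)
    where open SpanningPath p closed spanning

lemma2p1 : {n : ℕ} (G : Graph n) → Simple G → Connected G → MaxDegree G 2 →
    ¬ Iso G (cycle 4) → ¬ Iso G (cycle 7) →
    SSColorable G 3 × ZeroOneColorable G 3
lemma2p1 G simple connected (deg≤2 , v , _) ¬C₄ ¬C₇
  with MaxDegreeTwo.path-colourable-or-cycle G simple deg≤2 connected v
... | inj₁ path-colourable = path-colourable
... | inj₂ (last , 2≤last , C)
  with b , m , b*4<k , k+b≡m*3 ← cycle-jump-parameters (suc last) (s≤s 2≤last)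
                                   (λ { refl → ¬C₄ C }) (λ { refl → ¬C₇ C })
  = cycle-colourable G simple C (jumping-mod3-admissible _ b b*4<k) (jumping-mod3-periodic _ b m k+b≡m*3)
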